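{- Let $N\ge1$ and let $M$ be a positive integer such that $M^2$ divides $N$. Let $\sigma\in\operatorname{SL}_2(\mathbb{Z})$ satisfy $C(\sigma)=N/M$. Then $\sigma\,\Gamma_0(N;M)\,\sigma^{ -1}\subseteq \Gamma_0(N;M)$.
   Context: For $\tau=\begin{pmatrix}a&b\\c&d\end{pmatrix}\in\operatorname{SL}_2(\mathbb{Z})$, $C(\tau)=\gcd(c,N)$ (the denominator of the cusp $\tau(\infty)$ of $\Gamma_0(N)$; gcd's are taken positive). For a divisor $M$ of $N$, $\Gamma_0(N;M)=\left\{\begin{pmatrix}a&b\\c&d\end{pmatrix}\in\operatorname{SL}_2(\mathbb{Z}): a\equiv d\equiv 1 \bmod M,\ c\equiv 0\bmod N\right\}$. -}

module Defs where

open import Data.Nat as ℕ using (ℕ)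
open import Data.Nat.GCD using (gcd)
open import Data.Integer using (ℤ; +_; _+_; _*_; _-_; -_; ∣_∣; 1ℤ)
open import Data.Integer.Divisibility using (_∣_)
open import Data.Product using (_×_)
open import Relation.Binary.PropositionalEquality using (_≡_)

record SL2Z : Set where
  constructor mkSL2
  field
    a b c d : ℤ
    det≡1 : a * d - b * c ≡ 1ℤ
open SL2Z public

_≡_[mod_] : ℤ → ℤ → ℕ → Set
x ≡ y [mod m ] = (+ m) ∣ (x - y)

record Mat2 : Set where
  constructor mat
  field
    m11 m12 m21 m22 : ℤ
open Mat2 public

toMat : SL2Z → Mat2
toMat g = mat (a g) (b g) (c g) (d g)

_⊗_ : Mat2 → Mat2 → Mat2
mat p q r s ⊗ mat p' q' r' s' =
  mat (p * p' + q * r') (p * q' + q * s') (r * p' + s * r') (r * q' + s * s')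

inv : SL2Z → Mat2
inv g = mat (d g) (- b g) (- c g) (a g)

C : ℕ → SL2Z → ℕ
C N τ = gcd ∣ c τ ∣ N

InΓ₀ : ℕ → ℕ → Mat2 → Set
InΓ₀ N M g = (m11 g ≡ + 1 [mod M ]) × (m22 g ≡ + 1 [mod M ]) × (m21 g ≡ + 0 [mod N ])

conj : SL2Z → SL2Z → Mat2
conj σ γ = (toMat σ ⊗ toMat γ) ⊗ inv σ

module Submission where

-- With k = N / M we have N = k M, M ∣ k and k ∣ c(σ). Conjugating γ = (α β ; g δ) by
-- σ = (a b ; c d) gives diagonal entries congruent to ad − bc = 1 modulo M, since M divides
-- c, g, α − 1 and δ − 1; and lower-left entry cd(α − δ) + d²g − c²β, whose terms are
-- divisible by kM = N because k ∣ c while M divides both c and α − δ.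

open import Defs

module Γ₀-Conjugation where
  open import Data.Nat as ℕ using (ℕ)
  open import Data.Integer using (+_; 1ℤ; _+_; _-_; _*_; -_)
  open import Data.Integer.Properties using (+-identityˡ; +-identityʳ; pos-*)
  open import Data.Integer.Divisibility using () renaming (_∣_ to _∣ᵤ_)
  open import Data.Integer.Divisibility.Signed
  open import Data.Integer.Tactic.RingSolver using (solve-∀)
  open import Data.Product using (_×_; _,_; proj₁; proj₂)
  open import Relation.Binary.PropositionalEquality using (_≡_; sym; trans; cong; subst)

  *-pres-∣ : ∀ {i j m n} → i ∣ j → m ∣ n → i * m ∣ j * n
  *-pres-∣ {i} {n = n} i∣j m∣n = ∣-trans (*-monoʳ-∣ i m∣n) (*-monoˡ-∣ n i∣j)

  ≡0[mod]⇒∣ : ∀ {n x} → x ≡ + 0 [mod n ] → + n ∣ x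
  ≡0[mod]⇒∣ {n} {x} x≡0 = subst (+ n ∣_) (+-identityʳ x) (∣ᵤ⇒∣ x≡0)

  ∣⇒≡0[mod] : ∀ {n x} → + n ∣ x → x ≡ + 0 [mod n ]
  ∣⇒≡0[mod] {n} {x} n∣x = ∣⇒∣ᵤ (subst (+ n ∣_) (sym (+-identityʳ x)) n∣x)

  det-1+x≡x : ∀ σ x → a σ * d σ - b σ * c σ - 1ℤ + x ≡ x
  det-1+x≡x σ x = trans (cong (λ e → e - 1ℤ + x) (det≡1 σ)) (+-identityˡ x)

  conj-m11-1 : ∀ σ γ → m11 (conj σ γ) - 1ℤ ≡
    a σ * d σ * (a γ - 1ℤ) - b σ * c σ * (d γ - 1ℤ) + (b σ * d σ * c γ - a σ * c σ * b γ)
  conj-m11-1 σ γ = trans (expand (a σ) (b σ) (c σ) (d σ) (a γ) (b γ) (c γ) (d γ)) (det-1+x≡x σ _)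
    where
    expand : ∀ a b c d α β g δ →
      (a * α + b * g) * d + (a * β + b * δ) * - c - 1ℤ
        ≡ a * d - b * c - 1ℤ + (a * d * (α - 1ℤ) - b * c * (δ - 1ℤ) + (b * d * g - a * c * β))
    expand = solve-∀

  conj-m22-1 : ∀ σ γ → m22 (conj σ γ) - 1ℤ ≡
    a σ * d σ * (d γ - 1ℤ) - b σ * c σ * (a γ - 1ℤ) + (a σ * c σ * b γ - b σ * d σ * c γ)
  conj-m22-1 σ γ = trans (expand (a σ) (b σ) (c σ) (d σ) (a γ) (b γ) (c γ) (d γ)) (det-1+x≡x σ _)
    where
    expand : ∀ a b c d α β g δ →
      (c * α + d * g) * - b + (c * β + d * δ) * a - 1ℤ
        ≡ a * d - b * c - 1ℤ + (a * d * (δ - 1ℤ) - b * c * (α - 1ℤ) + (a * c * β - b * d * g))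
    expand = solve-∀

  conj-m21 : ∀ σ γ → m21 (conj σ γ) ≡
    d σ * (c σ * (a γ - d γ)) + d σ * d σ * c γ - c σ * c σ * b γ
  conj-m21 σ γ = expand (c σ) (d σ) (a γ) (b γ) (c γ) (d γ)
    where
    expand : ∀ c d α β g δ →
      (c * α + d * g) * d + (c * β + d * δ) * - c ≡ d * (c * (α - δ)) + d * d * g - c * c * β
    expand = solve-∀

  conj-diagonal-≡1 : ∀ {m} σ γ → m ∣ c σ → m ∣ c γ → m ∣ a γ - 1ℤ → m ∣ d γ - 1ℤ →
    m ∣ m11 (conj σ γ) - 1ℤ × m ∣ m22 (conj σ γ) - 1ℤ
  conj-diagonal-≡1 {m} σ γ m∣cσ m∣cγ m∣aγ-1 m∣dγ-1 =
    subst (m ∣_) (sym (conj-m11-1 σ γ))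
      (∣m∣n⇒∣m+n (∣m∣n⇒∣m-n (∣n⇒∣m*n (a σ * d σ) m∣aγ-1) (∣n⇒∣m*n (b σ * c σ) m∣dγ-1))
                 (∣m∣n⇒∣m-n (∣n⇒∣m*n (b σ * d σ) m∣cγ) m∣aσcσbγ)) ,
    subst (m ∣_) (sym (conj-m22-1 σ γ))
      (∣m∣n⇒∣m+n (∣m∣n⇒∣m-n (∣n⇒∣m*n (a σ * d σ) m∣dγ-1) (∣n⇒∣m*n (b σ * c σ) m∣aγ-1))
                 (∣m∣n⇒∣m-n m∣aσcσbγ (∣n⇒∣m*n (b σ * d σ) m∣cγ)))
    where
    m∣aσcσbγ : m ∣ a σ * c σ * b γ
    m∣aσcσbγ = ∣m⇒∣m*n (b γ) (∣n⇒∣m*n (a σ) m∣cσ)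

  conj-m21-divisible : ∀ {n} σ γ → n ∣ c σ * (a γ - d γ) → n ∣ c σ * c σ → n ∣ c γ →
    n ∣ m21 (conj σ γ)
  conj-m21-divisible {n} σ γ n∣cσ[aγ-dγ] n∣cσ² n∣cγ =
    subst (n ∣_) (sym (conj-m21 σ γ))
      (∣m∣n⇒∣m-n (∣m∣n⇒∣m+n (∣n⇒∣m*n (d σ) n∣cσ[aγ-dγ]) (∣n⇒∣m*n (d σ * d σ) n∣cγ))
                 (∣m⇒∣m*n (b γ) n∣cσ²))

  conj-preserves-Γ₀ : (k m : ℕ) (σ : SL2Z) → + m ∣ᵤ + k → + k ∣ᵤ c σ →
    (γ : SL2Z) → InΓ₀ (k ℕ.* m) m (toMat γ) → InΓ₀ (k ℕ.* m) m (conj σ γ)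
  conj-preserves-Γ₀ k m σ m∣ᵤk k∣ᵤcσ γ (aγ≡1 , dγ≡1 , cγ≡0) =
    ∣⇒∣ᵤ (proj₁ diagonal) , ∣⇒∣ᵤ (proj₂ diagonal) ,
    ∣⇒≡0[mod] (subst (_∣ m21 (conj σ γ)) (sym (pos-* k m))
      (conj-m21-divisible σ γ (*-pres-∣ k∣cσ m∣aγ-dγ) (*-pres-∣ k∣cσ m∣cσ) km∣cγ))
    where
    k∣cσ : + k ∣ c σ
    k∣cσ = ∣ᵤ⇒∣ k∣ᵤcσ
    m∣aγ-1 : + m ∣ a γ - 1ℤ
    m∣aγ-1 = ∣ᵤ⇒∣ aγ≡1
    m∣dγ-1 : + m ∣ d γ - 1ℤ
    m∣dγ-1 = ∣ᵤ⇒∣ dγ≡1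
    m∣cσ : + m ∣ c σ
    m∣cσ = ∣-trans (∣ᵤ⇒∣ m∣ᵤk) k∣cσ
    km∣cγ : + k * + m ∣ c γ
    km∣cγ = subst (_∣ c γ) (pos-* k m) (≡0[mod]⇒∣ cγ≡0)
    m∣cγ : + m ∣ c γ
    m∣cγ = ∣-trans (∣n⇒∣m*n (+ k) ∣-refl) km∣cγ
    m∣aγ-dγ : + m ∣ a γ - d γ
    m∣aγ-dγ = subst (+ m ∣_) (difference (a γ) (d γ)) (∣m∣n⇒∣m-n m∣aγ-1 m∣dγ-1)
      where
      difference : ∀ α δ → (α - 1ℤ) - (δ - 1ℤ) ≡ α - δ
      difference = solve-∀
    diagonal : + m ∣ m11 (conj σ γ) - 1ℤ × + m ∣ m22 (conj σ γ) - 1ℤ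
    diagonal = conj-diagonal-≡1 σ γ m∣cσ m∣cγ m∣aγ-1 m∣dγ-1

open Γ₀-Conjugation using (conj-preserves-Γ₀)
open import Data.Nat using (ℕ; NonZero; _*_; _/_)
open import Data.Nat.Divisibility using (_∣_; ∣-trans; m∣m*n; m*n∣o⇒m∣o/n)
open import Data.Nat.DivMod using (m/n*n≡m)
open import Data.Nat.GCD using (gcd[m,n]∣m)
open import Data.Integer using (∣_∣)
open import Relation.Binary.PropositionalEquality using (_≡_; subst)

proposition2p1 : (N M : ℕ) → .{{_ : NonZero N}} → .{{_ : NonZero M}} →
    (M * M) ∣ N → (σ : SL2Z) → C N σ ≡ N / M →
    (γ : SL2Z) → InΓ₀ N M (toMat γ) → InΓ₀ N M (conj σ γ)
proposition2p1 N M M*M∣N σ C≡N/M γ =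
  subst (λ n → InΓ₀ n M (toMat γ) → InΓ₀ n M (conj σ γ)) (m/n*n≡m M∣N)
    (conj-preserves-Γ₀ (N / M) M σ (m*n∣o⇒m∣o/n M M M*M∣N) N/M∣c γ)
  where
  M∣N : M ∣ N
  M∣N = ∣-trans (m∣m*n M) M*M∣N
  N/M∣c : N / M ∣ ∣ c σ ∣
  N/M∣c = subst (_∣ ∣ c σ ∣) C≡N/M (gcd[m,n]∣m ∣ c σ ∣ N)
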